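{- Let $\ell,k\geq 2$ be integers, and let $\mathcal{F}_1,\dots,\mathcal{F}_{k}\subset 2^{[n]}$ be such that $\ell$ divides $|F_1\cap\dots\cap F_{k}|$ for every choice of $F_{1}\in\mathcal{F}_1,\dots,F_{k}\in\mathcal{F}_{k}$. Then $|\mathcal{F}_{1}|\cdots|\mathcal{F}_{k}|\leq 2^{(k-1)n}$. -}

module Defs where

open import Data.Nat using (ℕ; zero; suc)
open import Data.Fin using (Fin)
open import Data.Fin.Subset using (Subset; _∩_; ⊤)
open import Data.List using (List)

-- A family of subsets of [n] = {0,…,n-1}: a duplicate-free list of subsets
-- (duplicate-freeness is imposed in the statement via Unique);
-- its cardinality is the length of the list.
Family : ℕ → Set
Family n = List (Subset n)

⋂ : ∀ {n} (k : ℕ) → (Fin k → Subset n) → Subset n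
⋂ zero    S = ⊤
⋂ (suc k) S = S Fin.zero ∩ ⋂ k (λ i → S (Fin.suc i))

module Submission where

-- Fix a prime p dividing ℓ. For two families F and G the characteristic vectors
-- of their members are pairwise orthogonal modulo p, and Gaussian elimination
-- over 𝔽ₚ yields a set S of coordinates such that each member of F is determined
-- by its trace on S and each member of G by its trace on the complement of S;
-- hence |F| |G| ≤ 2^|S| 2^(n - |S|) = 2ⁿ. For more families, the inequality
-- |F| |G| ≤ 2ⁿ |F ∧ G|, where F ∧ G = {A ∩ B : A ∈ F, B ∈ G}, allows replacing
-- F₁, F₂ by F₁ ∧ F₂, which keeps the divisibility hypothesis, and induction on k
-- finishes the proof.

open import Defs
open import Data.Nat using (ℕ; _≤_; _*_; _^_; _∸_)
open import Data.Nat.Divisibility using (_∣_)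
open import Data.Fin using (Fin)
open import Data.Fin.Subset using (Subset; ∣_∣)
open import Data.List using (List; length)
open import Data.List.Membership.Propositional using (_∈_)
open import Data.List.Relation.Unary.Unique.Propositional using (Unique)
open import Data.Vec.Functional using () renaming (foldr to vfoldr)

open import Level using (0ℓ)
open import Function using (_∘_)
open import Data.Nat using (zero; suc; _+_; z≤n; s≤s)
open import Data.Nat.Properties
  using (≤-refl; ≤-reflexive; ≤-trans; ≤-antisym; ≤-total; m≤m+n; m≤n⇒∃[o]m+o≡n; m+[n∸m]≡n;
         +-mono-≤; *-mono-≤; *-monoˡ-≤; *-monoʳ-≤; +-comm; +-identityʳ; *-identityʳ; *-assoc; *-distribˡ-+;
         ^-distribˡ-+-*; +-commutativeSemigroup; module ≤-Reasoning)
open import Data.Nat.Tactic.RingSolver using (solve-∀)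
open import Algebra.Properties.CommutativeSemigroup +-commutativeSemigroup using (interchange)
open import Data.Nat.Divisibility using (∣-trans; m∣m*n)
open import Data.Nat.Primality using (Prime)
open import Data.Nat.Primality.Factorisation using (factorise)
open import Data.Nat.ListAction using (product)
open import Data.Bool using (Bool; if_then_else_)
import Data.Bool as Bool
import Data.Unit as Unit
open import Data.Empty using (⊥-elim)
open import Data.Product using (∃-syntax; _×_; _,_; proj₁; proj₂)
open import Data.Sum using (inj₁; inj₂; [_,_]′)
open import Data.Fin using (zero; suc)
open import Data.Fin.Subset using (inside; outside; _∩_; ⊤; ∁)
open import Data.Fin.Subset.Properties using (∣p∣≤n; ∣∁p∣≡n∸∣p∣; ∩-assoc; ∩-identityʳ)
open import Data.Vec using (Vec; []; _∷_; map; zipWith)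
open import Data.Vec.Properties using (∷-injectiveʳ; ≡-dec)
open import Data.List using ([]; _∷_; cartesianProductWith)
open import Data.List.Relation.Unary.Any using (toSum; fromSum)
open import Data.List.Relation.Unary.All using (_∷_) renaming (lookup to All-lookup)
open import Data.List.Relation.Unary.AllPairs using (_∷_)
open import Data.List.Membership.Propositional.Properties using (∈-cartesianProductWith⁺; ∈-cartesianProductWith⁻)
import Data.List.Membership.DecPropositional as DecMembership
open import Relation.Unary using (Pred; Decidable; _∪_; _⊆_; _≐_)
open import Relation.Unary.Properties using (_∪?_)
open import Relation.Nullary using (¬_; Dec; does; yes; no)
open import Relation.Binary using (Rel; DecidableEquality)
open import Relation.Binary.PropositionalEquality using (_≡_; _≢_; refl; sym; trans; cong; cong₂; subst; module ≡-Reasoning)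

-- Counting subsets of [n]

infix 4 _≟_ _∈?_

_≟_ : ∀ {n} → DecidableEquality (Subset n)
_≟_ = ≡-dec Bool._≟_

_∈?_ : ∀ {n} (A : Subset n) (F : Family n) → Dec (A ∈ F)
_∈?_ = DecMembership._∈?_ _≟_

count : ∀ {n} {P : Pred (Subset n) 0ℓ} → Decidable P → ℕ
count {zero}  P? = if does (P? []) then 1 else 0
count {suc n} P? = count (P? ∘ (outside ∷_)) + count (P? ∘ (inside ∷_))

2^n+2^n≡2^[1+n] : ∀ n → 2 ^ n + 2 ^ n ≡ 2 ^ suc n
2^n+2^n≡2^[1+n] n = cong (2 ^ n +_) (sym (+-identityʳ (2 ^ n)))

count≤2^n : ∀ {n} {P : Pred (Subset n) 0ℓ} (P? : Decidable P) → count P? ≤ 2 ^ n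
count≤2^n {zero} P? with P? []
... | yes _ = ≤-refl
... | no  _ = z≤n
count≤2^n {suc n} P? =
  ≤-trans (+-mono-≤ (count≤2^n (P? ∘ (outside ∷_))) (count≤2^n (P? ∘ (inside ∷_))))
          (≤-reflexive (2^n+2^n≡2^[1+n] n))

count-mono : ∀ {n} {P Q : Pred (Subset n) 0ℓ} (P? : Decidable P) (Q? : Decidable Q) →
             P ⊆ Q → count P? ≤ count Q?
count-mono {zero} P? Q? P⊆Q with P? [] | Q? []
... | yes _ | yes _ = ≤-refl
... | yes p | no ¬q = ⊥-elim (¬q (P⊆Q p))
... | no _  | _     = z≤n
count-mono {suc n} P? Q? P⊆Q =
  +-mono-≤ (count-mono (P? ∘ (outside ∷_)) (Q? ∘ (outside ∷_)) P⊆Q)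
           (count-mono (P? ∘ (inside ∷_)) (Q? ∘ (inside ∷_)) P⊆Q)

count-cong : ∀ {n} {P Q : Pred (Subset n) 0ℓ} (P? : Decidable P) (Q? : Decidable Q) →
             P ≐ Q → count P? ≡ count Q?
count-cong P? Q? (P⊆Q , Q⊆P) = ≤-antisym (count-mono P? Q? P⊆Q) (count-mono Q? P? Q⊆P)

count-empty : ∀ {n} {P : Pred (Subset n) 0ℓ} (P? : Decidable P) → (∀ {A} → ¬ P A) → count P? ≡ 0
count-empty {zero} P? ¬P with P? []
... | yes p = ⊥-elim (¬P p)
... | no  _ = refl
count-empty {suc n} P? ¬P =
  cong₂ _+_ (count-empty (P? ∘ (outside ∷_)) ¬P) (count-empty (P? ∘ (inside ∷_)) ¬P)

count-singleton : ∀ {n} (A : Subset n) → count (_≟ A) ≡ 1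
count-singleton []            = refl
count-singleton (outside ∷ A) = cong₂ _+_
  (trans (count-cong (λ B → outside ∷ B ≟ outside ∷ A) (_≟ A) (∷-injectiveʳ , cong (outside ∷_)))
         (count-singleton A))
  (count-empty (λ B → inside ∷ B ≟ outside ∷ A) λ ())
count-singleton (inside ∷ A)  = cong₂ _+_
  (count-empty (λ B → outside ∷ B ≟ inside ∷ A) λ ())
  (trans (count-cong (λ B → inside ∷ B ≟ inside ∷ A) (_≟ A) (∷-injectiveʳ , cong (inside ∷_)))
         (count-singleton A))

count-∪ : ∀ {n} {P Q : Pred (Subset n) 0ℓ} (P? : Decidable P) (Q? : Decidable Q) →
          (∀ {A} → P A → ¬ Q A) → count (P? ∪? Q?) ≡ count P? + count Q?
count-∪ {zero} P? Q? disjoint with P? [] | Q? []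
... | yes p | yes q = ⊥-elim (disjoint p q)
... | yes _ | no _  = refl
... | no _  | yes _ = refl
... | no _  | no _  = refl
count-∪ {suc n} P? Q? disjoint = trans
  (cong₂ _+_ (count-∪ (P? ∘ (outside ∷_)) (Q? ∘ (outside ∷_)) disjoint)
             (count-∪ (P? ∘ (inside ∷_)) (Q? ∘ (inside ∷_)) disjoint))
  (interchange (count (P? ∘ (outside ∷_))) (count (Q? ∘ (outside ∷_)))
               (count (P? ∘ (inside ∷_))) (count (Q? ∘ (inside ∷_))))

-- The number of distinct members of a family; a list may repeat a set.
size : ∀ {n} → Family n → ℕ
size F = count (_∈? F)

size≡length : ∀ {n} (F : Family n) → Unique F → size F ≡ length F
size≡length {n} []      _            = count-empty {n} (_∈? []) λ ()
size≡length     (A ∷ F) (A∉F ∷ uniq) = begin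
  count (_∈? A ∷ F)             ≡⟨ count-cong (_∈? A ∷ F) ((_≟ A) ∪? (_∈? F)) (toSum , fromSum) ⟩
  count ((_≟ A) ∪? (_∈? F))     ≡⟨ count-∪ (_≟ A) (_∈? F) (λ { refl B∈F → All-lookup A∉F B∈F refl }) ⟩
  count (_≟ A) + size F         ≡⟨ cong₂ _+_ (count-singleton A) (size≡length F uniq) ⟩
  suc (length F)                ∎
  where open ≡-Reasoning

-- Coordinate sets that determine a family

AgreeOn : ∀ {n} {A : Set} → Rel A 0ℓ → Subset n → Rel (Vec A n) 0ℓ
AgreeOn R []            []      []      = Unit.⊤
AgreeOn R (inside ∷ S)  (a ∷ x) (b ∷ y) = R a b × AgreeOn R S x y
AgreeOn R (outside ∷ S) (_ ∷ x) (_ ∷ y) = AgreeOn R S x y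

Determines : ∀ {n} {A : Set} → Rel A 0ℓ → Subset n → Pred (Vec A n) 0ℓ → Set
Determines R S P = ∀ {x y} → P x → P y → AgreeOn R S x y → AgreeOn R ⊤ x y

agree-refl : ∀ {n} {A : Set} {R : Rel A 0ℓ} → (∀ {a} → R a a) → (S : Subset n) (x : Vec A n) → AgreeOn R S x x
agree-refl refl′ []            []      = Unit.tt
agree-refl refl′ (inside ∷ S)  (a ∷ x) = refl′ , agree-refl refl′ S x
agree-refl refl′ (outside ∷ S) (a ∷ x) = agree-refl refl′ S x

agree-map : ∀ {n} {A B : Set} {R : Rel A 0ℓ} {R′ : Rel B 0ℓ} {f : A → B} → (∀ {a b} → R a b → R′ (f a) (f b)) →
            (S : Subset n) {x y : Vec A n} → AgreeOn R S x y → AgreeOn R′ S (map f x) (map f y)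
agree-map f-resp []            {[]}    {[]}    _          = Unit.tt
agree-map f-resp (inside ∷ S)  {_ ∷ _} {_ ∷ _} (ab , xy) = f-resp ab , agree-map f-resp S xy
agree-map f-resp (outside ∷ S) {_ ∷ _} {_ ∷ _} xy        = agree-map f-resp S xy

agree-map⁻ : ∀ {n} {A B : Set} {R : Rel A 0ℓ} {R′ : Rel B 0ℓ} {f : A → B} → (∀ {a b} → R′ (f a) (f b) → R a b) →
             (S : Subset n) {x y : Vec A n} → AgreeOn R′ S (map f x) (map f y) → AgreeOn R S x y
agree-map⁻ f-refl []            {[]}    {[]}    _          = Unit.tt
agree-map⁻ f-refl (inside ∷ S)  {_ ∷ _} {_ ∷ _} (ab , xy) = f-refl ab , agree-map⁻ f-refl S xy
agree-map⁻ f-refl (outside ∷ S) {_ ∷ _} {_ ∷ _} xy        = agree-map⁻ f-refl S xy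

zipWith-agree : ∀ {n} {A C : Set} {R : Rel A 0ℓ} {f g : A → C → A} →
                (∀ {a₁ a₂} c → R a₁ a₂ → R (f a₁ c) (g a₂ c)) →
                (S : Subset n) {u₁ u₂ : Vec A n} (v : Vec C n) →
                AgreeOn R S u₁ u₂ → AgreeOn R S (zipWith f u₁ v) (zipWith g u₂ v)
zipWith-agree f~g []            {[]}    {[]}    []      _          = Unit.tt
zipWith-agree f~g (inside ∷ S)  {_ ∷ _} {_ ∷ _} (c ∷ v) (a~ , u~) = f~g c a~ , zipWith-agree f~g S v u~
zipWith-agree f~g (outside ∷ S) {_ ∷ _} {_ ∷ _} (c ∷ v) u~        = zipWith-agree f~g S v u~

zipWith-agree⁻ : ∀ {n} {A C : Set} {R : Rel A 0ℓ} {f g : A → C → A} →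
                 (∀ {a₁ a₂} c → R (f a₁ c) (g a₂ c) → R a₁ a₂) →
                 (S : Subset n) {u₁ u₂ : Vec A n} (v : Vec C n) →
                 AgreeOn R S (zipWith f u₁ v) (zipWith g u₂ v) → AgreeOn R S u₁ u₂
zipWith-agree⁻ f~g []            {[]}    {[]}    []      _          = Unit.tt
zipWith-agree⁻ f~g (inside ∷ S)  {_ ∷ _} {_ ∷ _} (c ∷ v) (a~ , u~) = f~g c a~ , zipWith-agree⁻ f~g S v u~
zipWith-agree⁻ f~g (outside ∷ S) {_ ∷ _} {_ ∷ _} (c ∷ v) u~        = zipWith-agree⁻ f~g S v u~

count≤2^∣S∣ : ∀ {n} {P : Pred (Subset n) 0ℓ} (P? : Decidable P) (S : Subset n) →
              Determines _≡_ S P → count P? ≤ 2 ^ ∣ S ∣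
count≤2^∣S∣ P? []            _           = count≤2^n P?
count≤2^∣S∣ P? (inside ∷ S)  S-determines = begin
  count (P? ∘ (outside ∷_)) + count (P? ∘ (inside ∷_))
    ≤⟨ +-mono-≤ (count≤2^∣S∣ (P? ∘ (outside ∷_)) S λ pA pB A~B → proj₂ (S-determines pA pB (refl , A~B)))
                (count≤2^∣S∣ (P? ∘ (inside ∷_)) S λ pA pB A~B → proj₂ (S-determines pA pB (refl , A~B))) ⟩
  2 ^ ∣ S ∣ + 2 ^ ∣ S ∣
    ≡⟨ 2^n+2^n≡2^[1+n] ∣ S ∣ ⟩
  2 ^ suc ∣ S ∣ ∎
  where open ≤-Reasoning
count≤2^∣S∣ {P = P} P? (outside ∷ S) S-determines = begin
  count P₀? + count P₁?    ≡⟨ count-∪ P₀? P₁? disjoint ⟨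
  count (P₀? ∪? P₁?)       ≤⟨ count≤2^∣S∣ (P₀? ∪? P₁?) S S-determines-trace ⟩
  2 ^ ∣ S ∣                ∎
  where
  open ≤-Reasoning
  P₀? = P? ∘ (outside ∷_)
  P₁? = P? ∘ (inside ∷_)
  outside≢inside : outside ≢ inside
  outside≢inside ()
  disjoint : ∀ {A} → P (outside ∷ A) → ¬ P (inside ∷ A)
  disjoint {A} p q = outside≢inside (proj₁ (S-determines p q (agree-refl refl S A)))
  lift : ∀ {A} → (P ∘ (outside ∷_) ∪ P ∘ (inside ∷_)) A → ∃[ a ] P (a ∷ A)
  lift = [ (outside ,_) , (inside ,_) ]′
  S-determines-trace : Determines _≡_ S (P ∘ (outside ∷_) ∪ P ∘ (inside ∷_))
  S-determines-trace pA pB A~B with lift pA | lift pB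
  ... | _ , pA′ | _ , pB′ = proj₂ (S-determines pA′ pB′ A~B)

∣S∣+∣∁S∣≡n : ∀ {n} (S : Subset n) → ∣ S ∣ + ∣ ∁ S ∣ ≡ n
∣S∣+∣∁S∣≡n S = trans (cong (∣ S ∣ +_) (∣∁p∣≡n∸∣p∣ S)) (m+[n∸m]≡n (∣p∣≤n S))

count*count≤2^n : ∀ {n} {P Q : Pred (Subset n) 0ℓ} (P? : Decidable P) (Q? : Decidable Q) (S : Subset n) →
                  Determines _≡_ S P → Determines _≡_ (∁ S) Q → count P? * count Q? ≤ 2 ^ n
count*count≤2^n {n} P? Q? S S-determines ∁S-determines = begin
  count P? * count Q?          ≤⟨ *-mono-≤ (count≤2^∣S∣ P? S S-determines) (count≤2^∣S∣ Q? (∁ S) ∁S-determines) ⟩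
  2 ^ ∣ S ∣ * 2 ^ ∣ ∁ S ∣      ≡⟨ ^-distribˡ-+-* 2 ∣ S ∣ ∣ ∁ S ∣ ⟨
  2 ^ (∣ S ∣ + ∣ ∁ S ∣)        ≡⟨ cong (2 ^_) (∣S∣+∣∁S∣≡n S) ⟩
  2 ^ n                        ∎
  where open ≤-Reasoning

-- The inequality |F| |G| ≤ 2ⁿ |F ∧ G|

rearrangement : ∀ {a₀ a₁ b₀ b₁} → a₁ ≤ a₀ → b₁ ≤ b₀ → a₀ * b₁ + a₁ * b₀ ≤ a₀ * b₀ + a₁ * b₁
rearrangement {a₁ = a₁} {b₁ = b₁} a₁≤a₀ b₁≤b₀ with m≤n⇒∃[o]m+o≡n a₁≤a₀ | m≤n⇒∃[o]m+o≡n b₁≤b₀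
... | d , refl | e , refl = ≤-trans (m≤m+n _ (d * e)) (≤-reflexive (identity a₁ d b₁ e))
  where
  identity : ∀ a d b e → (a + d) * b + a * (b + e) + d * e ≡ (a + d) * (b + e) + a * b
  identity = solve-∀

cross-terms≤ : ∀ a₀ a₁ b₀ b₁ {u v} → a₀ * b₀ ≤ u → a₀ * b₁ ≤ u → a₁ * b₀ ≤ u → a₁ * b₁ ≤ v →
               a₀ * b₁ + a₁ * b₀ ≤ u + v
cross-terms≤ a₀ a₁ b₀ b₁ {u} {v} h₀₀ h₀₁ h₁₀ h₁₁ with ≤-total a₀ a₁ | ≤-total b₀ b₁
... | inj₁ a₀≤a₁ | _ = ≤-trans (+-mono-≤ (≤-trans (*-monoˡ-≤ b₁ a₀≤a₁) h₁₁) h₁₀) (≤-reflexive (+-comm v u))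
... | inj₂ _ | inj₁ b₀≤b₁ = +-mono-≤ h₀₁ (≤-trans (*-monoʳ-≤ a₁ b₀≤b₁) h₁₁)
... | inj₂ a₁≤a₀ | inj₂ b₁≤b₀ = ≤-trans (rearrangement a₁≤a₀ b₁≤b₀) (+-mono-≤ h₀₀ h₁₁)

product≤ : ∀ a₀ a₁ b₀ b₁ {u v} → a₀ * b₀ ≤ u → a₀ * b₁ ≤ u → a₁ * b₀ ≤ u → a₁ * b₁ ≤ v →
           (a₀ + a₁) * (b₀ + b₁) ≤ 2 * (u + v)
product≤ a₀ a₁ b₀ b₁ {u} {v} h₀₀ h₀₁ h₁₀ h₁₁ = begin
  (a₀ + a₁) * (b₀ + b₁)                        ≡⟨ expand a₀ a₁ b₀ b₁ ⟩
  (a₀ * b₀ + a₁ * b₁) + (a₀ * b₁ + a₁ * b₀)    ≤⟨ +-mono-≤ (+-mono-≤ h₀₀ h₁₁) (cross-terms≤ a₀ a₁ b₀ b₁ h₀₀ h₀₁ h₁₀ h₁₁) ⟩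
  (u + v) + (u + v)                            ≡⟨ double (u + v) ⟩
  2 * (u + v)                                  ∎
  where
  open ≤-Reasoning
  expand : ∀ a₀ a₁ b₀ b₁ → (a₀ + a₁) * (b₀ + b₁) ≡ (a₀ * b₀ + a₁ * b₁) + (a₀ * b₁ + a₁ * b₀)
  expand = solve-∀
  double : ∀ w → w + w ≡ 2 * w
  double = solve-∀

count*count≤2^n*count-∩ :
  ∀ {n} {P Q R : Pred (Subset n) 0ℓ} (P? : Decidable P) (Q? : Decidable Q) (R? : Decidable R) →
  (∀ {A B} → P A → Q B → R (A ∩ B)) → count P? * count Q? ≤ 2 ^ n * count R?
count*count≤2^n*count-∩ {zero} P? Q? R? ∩-closed with P? [] | Q? [] | R? []
... | yes _ | yes _ | yes _ = ≤-refl
... | yes p | yes q | no ¬r = ⊥-elim (¬r (∩-closed p q))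
... | yes _ | no _  | _     = z≤n
... | no _  | _     | _     = z≤n
-- With the index i meaning first coordinate i: R₀ contains (P₀ ∪ P₁) ∧ Q₀ and
-- P₀ ∧ (Q₀ ∪ Q₁), and R₁ contains P₁ ∧ Q₁.
count*count≤2^n*count-∩ {suc n} {P} {Q} P? Q? R? ∩-closed = begin
  (count P₀? + count P₁?) * (count Q₀? + count Q₁?)
    ≤⟨ product≤ (count P₀?) (count P₁?) (count Q₀?) (count Q₁?) P₀Q₀ P₀Q₁ P₁Q₀ P₁Q₁ ⟩
  2 * (2 ^ n * count R₀? + 2 ^ n * count R₁?)
    ≡⟨ cong (2 *_) (*-distribˡ-+ (2 ^ n) (count R₀?) (count R₁?)) ⟨
  2 * (2 ^ n * (count R₀? + count R₁?))
    ≡⟨ *-assoc 2 (2 ^ n) _ ⟨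
  2 ^ suc n * (count R₀? + count R₁?) ∎
  where
  open ≤-Reasoning
  P₀? = P? ∘ (outside ∷_)
  P₁? = P? ∘ (inside ∷_)
  Q₀? = Q? ∘ (outside ∷_)
  Q₁? = Q? ∘ (inside ∷_)
  R₀? = R? ∘ (outside ∷_)
  R₁? = R? ∘ (inside ∷_)
  P₀₁? = P₀? ∪? P₁?
  Q₀₁? = Q₀? ∪? Q₁?
  bound₁ : count P₀₁? * count Q₀? ≤ 2 ^ n * count R₀?
  bound₁ = count*count≤2^n*count-∩ P₀₁? Q₀? R₀? [ ∩-closed , ∩-closed ]′
  bound₂ : count P₀? * count Q₀₁? ≤ 2 ^ n * count R₀?
  bound₂ = count*count≤2^n*count-∩ P₀? Q₀₁? R₀? λ p → [ ∩-closed p , ∩-closed p ]′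
  P₀Q₀ : count P₀? * count Q₀? ≤ 2 ^ n * count R₀?
  P₀Q₀ = ≤-trans (*-monoˡ-≤ (count Q₀?) (count-mono P₀? P₀₁? inj₁)) bound₁
  P₁Q₀ : count P₁? * count Q₀? ≤ 2 ^ n * count R₀?
  P₁Q₀ = ≤-trans (*-monoˡ-≤ (count Q₀?) (count-mono P₁? P₀₁? inj₂)) bound₁
  P₀Q₁ : count P₀? * count Q₁? ≤ 2 ^ n * count R₀?
  P₀Q₁ = ≤-trans (*-monoʳ-≤ (count P₀?) (count-mono Q₁? Q₀₁? inj₂)) bound₂
  P₁Q₁ : count P₁? * count Q₁? ≤ 2 ^ n * count R₁?
  P₁Q₁ = count*count≤2^n*count-∩ P₁? Q₁? R₁? ∩-closed

-- Orthogonal families of integer vectors modulo a prime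

module ModuloPrime (p : ℕ) (p-prime : Prime p) where

  open import Data.Integer as ℤ using (ℤ; +_; -_; _-_; 0ℤ; 1ℤ)
  open import Data.Integer.Properties using (abs-*)
  open import Data.Integer.Divisibility.Signed as ℤ∣
    using (_∣?_; ∣ᵤ⇒∣; ∣⇒∣ᵤ; ∣m∣n⇒∣m+n; ∣m∣n⇒∣m-n; ∣n⇒∣m*n; ∣m⇒∣-m)
  open import Data.Integer.Tactic.RingSolver using () renaming (solve-∀ to solve-∀ℤ)
  open import Data.Nat.Primality using (euclidsLemma; ¬prime[1])
  import Data.Nat.Divisibility as ℕ∣
  open import Data.Vec using (head; tail)
  import Data.List as List
  open import Data.List.Relation.Unary.All using (all?)
  open import Data.List.Relation.Unary.All.Properties using (¬All⇒Any¬)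
  open import Data.List.Membership.Propositional using (find)
  open import Data.List.Membership.Propositional.Properties using (∈-map⁺; ∈-map⁻)
  import Relation.Nullary.Decidable as Dec
  open import Relation.Binary using (Setoid)

  infix 4 _≈_ _≉_ _≈?_

  -- Congruence modulo p, as a record so that a and b can be inferred.
  record _≈_ (a b : ℤ) : Set where
    constructor ≈-intro
    field ∣difference : + p ℤ∣.∣ a - b
  open _≈_

  _≉_ : ℤ → ℤ → Set
  a ≉ b = ¬ a ≈ b

  _≈?_ : (a b : ℤ) → Dec (a ≈ b)
  a ≈? b = Dec.map′ ≈-intro ∣difference (+ p ∣? a - b)

  ≈-by : ∀ {a b c} → a - b ≡ c → + p ℤ∣.∣ c → a ≈ b
  ≈-by a-b≡c = ≈-intro ∘ subst (+ p ℤ∣.∣_) (sym a-b≡c)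

  ≈-refl : ∀ {a} → a ≈ a
  ≈-refl {a} = ≈-by (identity a) (∣ᵤ⇒∣ (ℕ∣._∣0 p))
    where identity : ∀ a → a - a ≡ 0ℤ
          identity = solve-∀ℤ

  ≈-sym : ∀ {a b} → a ≈ b → b ≈ a
  ≈-sym {a} {b} a≈b = ≈-by (identity a b) (∣m⇒∣-m (∣difference a≈b))
    where identity : ∀ a b → b - a ≡ - (a - b)
          identity = solve-∀ℤ

  ≈-trans : ∀ {a b c} → a ≈ b → b ≈ c → a ≈ c
  ≈-trans {a} {b} {c} a≈b b≈c = ≈-by (identity a b c) (∣m∣n⇒∣m+n (∣difference a≈b) (∣difference b≈c))
    where identity : ∀ a b c → a - c ≡ (a - b) ℤ.+ (b - c)
          identity = solve-∀ℤ

  ≈-setoid : Setoid 0ℓ 0ℓ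
  ≈-setoid = record
    { _≈_ = _≈_ ; isEquivalence = record { refl = ≈-refl ; sym = ≈-sym ; trans = ≈-trans } }

  open import Relation.Binary.Reasoning.Setoid ≈-setoid

  +-cong : ∀ {a b c d} → a ≈ b → c ≈ d → a ℤ.+ c ≈ b ℤ.+ d
  +-cong {a} {b} {c} {d} a≈b c≈d = ≈-by (identity a b c d) (∣m∣n⇒∣m+n (∣difference a≈b) (∣difference c≈d))
    where identity : ∀ a b c d → (a ℤ.+ c) - (b ℤ.+ d) ≡ (a - b) ℤ.+ (c - d)
          identity = solve-∀ℤ

  -‿cong : ∀ {a b c d} → a ≈ b → c ≈ d → a - c ≈ b - d
  -‿cong {a} {b} {c} {d} a≈b c≈d = ≈-by (identity a b c d) (∣m∣n⇒∣m-n (∣difference a≈b) (∣difference c≈d))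
    where identity : ∀ a b c d → (a - c) - (b - d) ≡ (a - b) - (c - d)
          identity = solve-∀ℤ

  *-congˡ : ∀ c {a b} → a ≈ b → c ℤ.* a ≈ c ℤ.* b
  *-congˡ c {a} {b} a≈b = ≈-by (identity c a b) (∣n⇒∣m*n c (∣difference a≈b))
    where identity : ∀ c a b → c ℤ.* a - c ℤ.* b ≡ c ℤ.* (a - b)
          identity = solve-∀ℤ

  *-congʳ : ∀ c {a b} → a ≈ b → a ℤ.* c ≈ b ℤ.* c
  *-congʳ c {a} {b} a≈b = ≈-by (identity c a b) (∣n⇒∣m*n c (∣difference a≈b))
    where identity : ∀ c a b → a ℤ.* c - b ℤ.* c ≡ c ℤ.* (a - b)
          identity = solve-∀ℤ

  ≈0-intro : ∀ {a} → + p ℤ∣.∣ a → a ≈ 0ℤ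
  ≈0-intro {a} = ≈-by (identity a)
    where identity : ∀ a → a - 0ℤ ≡ a
          identity = solve-∀ℤ

  *-cancelˡ : ∀ {c a b} → c ≉ 0ℤ → c ℤ.* a ≈ c ℤ.* b → a ≈ b
  *-cancelˡ {c} {a} {b} c≉0 ca≈cb =
    [ (λ p∣c → ⊥-elim (c≉0 (≈0-intro (∣ᵤ⇒∣ p∣c)))) , ≈-intro ∘ ∣ᵤ⇒∣ ]′
      (euclidsLemma ℤ.∣ c ∣ ℤ.∣ a - b ∣ p-prime p∣∣c∣*∣a-b∣)
    where
    identity : ∀ c a b → c ℤ.* a - c ℤ.* b ≡ c ℤ.* (a - b)
    identity = solve-∀ℤ
    p∣∣c∣*∣a-b∣ : p ℕ∣.∣ ℤ.∣ c ∣ * ℤ.∣ a - b ∣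
    p∣∣c∣*∣a-b∣ =
      subst (p ℕ∣.∣_) (abs-* c (a - b)) (∣⇒∣ᵤ (subst (+ p ℤ∣.∣_) (identity c a b) (∣difference ca≈cb)))

  _≈[_]_ : ∀ {n} → Vec ℤ n → Subset n → Vec ℤ n → Set
  x ≈[ S ] y = AgreeOn _≈_ S x y

  _≋_ : ∀ {n} → Vec ℤ n → Vec ℤ n → Set
  x ≋ y = x ≈[ ⊤ ] y

  dot : ∀ {n} → Vec ℤ n → Vec ℤ n → ℤ
  dot []      []      = 0ℤ
  dot (a ∷ x) (b ∷ y) = a ℤ.* b ℤ.+ dot x y

  dot-congʳ : ∀ {n} (x : Vec ℤ n) {y₁ y₂} → y₁ ≋ y₂ → dot x y₁ ≈ dot x y₂
  dot-congʳ []      {[]}    {[]}    _              = ≈-refl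
  dot-congʳ (a ∷ x) {_ ∷ _} {_ ∷ _} (b₁≈b₂ , y₁≋y₂) = +-cong (*-congˡ a b₁≈b₂) (dot-congʳ x y₁≋y₂)

  -- For a pivot x₀ = h₀ ∷ t₀ and x = h ∷ t: the tail of h₀ x - h x₀, whose head is 0.
  eliminate : ∀ {n} → Vec ℤ (suc n) → Vec ℤ (suc n) → Vec ℤ n
  eliminate (h₀ ∷ t₀) (h ∷ t) = zipWith (λ a c → h₀ ℤ.* a - h ℤ.* c) t t₀

  dot-zipWith : ∀ {n} c d (t t₀ s : Vec ℤ n) →
                dot (zipWith (λ a e → c ℤ.* a - d ℤ.* e) t t₀) s ≡ c ℤ.* dot t s - d ℤ.* dot t₀ s
  dot-zipWith c d []      []        []      = identity c d
    where identity : ∀ c d → 0ℤ ≡ c ℤ.* 0ℤ - d ℤ.* 0ℤ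
          identity = solve-∀ℤ
  dot-zipWith c d (a ∷ t) (e ∷ t₀) (b ∷ s) =
    trans (cong (ℤ._+_ ((c ℤ.* a - d ℤ.* e) ℤ.* b)) (dot-zipWith c d t t₀ s)) (identity c d a e b (dot t s) (dot t₀ s))
    where identity : ∀ c d a e b T T₀ →
                     (c ℤ.* a - d ℤ.* e) ℤ.* b ℤ.+ (c ℤ.* T - d ℤ.* T₀) ≡ c ℤ.* (a ℤ.* b ℤ.+ T) - d ℤ.* (e ℤ.* b ℤ.+ T₀)
          identity = solve-∀ℤ

  dot-eliminate : ∀ {n} (x₀ x y : Vec ℤ (suc n)) →
                  dot (eliminate x₀ x) (tail y) ≡ head x₀ ℤ.* dot x y - head x ℤ.* dot x₀ y
  dot-eliminate (h₀ ∷ t₀) (h ∷ t) (g ∷ s) =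
    trans (dot-zipWith h₀ h t t₀ s) (identity h₀ h g (dot t s) (dot t₀ s))
    where identity : ∀ h₀ h g T T₀ →
                     h₀ ℤ.* T - h ℤ.* T₀ ≡ h₀ ℤ.* (h ℤ.* g ℤ.+ T) - h ℤ.* (h₀ ℤ.* g ℤ.+ T₀)
          identity = solve-∀ℤ

  eliminate-agree : ∀ {n} (x₀ : Vec ℤ (suc n)) (S : Subset n) {x₁ x₂} →
                    head x₁ ≈ head x₂ → tail x₁ ≈[ S ] tail x₂ → eliminate x₀ x₁ ≈[ S ] eliminate x₀ x₂
  eliminate-agree (h₀ ∷ t₀) S {_ ∷ _} {_ ∷ _} h₁≈h₂ =
    zipWith-agree (λ c a₁≈a₂ → -‿cong (*-congˡ h₀ a₁≈a₂) (*-congʳ c h₁≈h₂)) S t₀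

  eliminate-cancel : ∀ {n} (x₀ : Vec ℤ (suc n)) {x₁ x₂} → head x₀ ≉ 0ℤ →
                     head x₁ ≈ head x₂ → eliminate x₀ x₁ ≋ eliminate x₀ x₂ → tail x₁ ≋ tail x₂
  eliminate-cancel (h₀ ∷ t₀) {h₁ ∷ _} {h₂ ∷ _} h₀≉0 h₁≈h₂ =
    zipWith-agree⁻ (λ c e → *-cancelˡ h₀≉0 (cancel-second c e)) ⊤ t₀
    where
    identity : ∀ u v → u ≡ (u - v) ℤ.+ v
    identity = solve-∀ℤ
    cancel-second : ∀ {a₁ a₂} c → h₀ ℤ.* a₁ - h₁ ℤ.* c ≈ h₀ ℤ.* a₂ - h₂ ℤ.* c → h₀ ℤ.* a₁ ≈ h₀ ℤ.* a₂
    cancel-second {a₁} {a₂} c e = begin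
      h₀ ℤ.* a₁                              ≡⟨ identity _ (h₁ ℤ.* c) ⟩
      (h₀ ℤ.* a₁ - h₁ ℤ.* c) ℤ.+ h₁ ℤ.* c    ≈⟨ +-cong e (*-congʳ c h₁≈h₂) ⟩
      (h₀ ℤ.* a₂ - h₂ ℤ.* c) ℤ.+ h₂ ℤ.* c    ≡⟨ identity _ (h₂ ℤ.* c) ⟨
      h₀ ℤ.* a₂                              ∎

  Orthogonal : ∀ {n} → List (Vec ℤ n) → List (Vec ℤ n) → Set
  Orthogonal X Y = ∀ {x y} → x ∈ X → y ∈ Y → dot x y ≈ 0ℤ

  orthogonal-map : ∀ {m} {A B : Set} {X : List A} {Y : List B} {f : A → Vec ℤ m} {g : B → Vec ℤ m} →
                   (∀ {x y} → x ∈ X → y ∈ Y → dot (f x) (g y) ≈ 0ℤ) → Orthogonal (List.map f X) (List.map g Y)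
  orthogonal-map {f = f} {g} fX⊥gY fx∈ gy∈ with ∈-map⁻ f fx∈ | ∈-map⁻ g gy∈
  ... | _ , x∈X , refl | _ , y∈Y , refl = fX⊥gY x∈X y∈Y

  orthogonal-tail : ∀ {n} {X Y : List (Vec ℤ (suc n))} → (∀ {x} → x ∈ X → head x ≈ 0ℤ) →
                    Orthogonal X Y → Orthogonal (List.map tail X) (List.map tail Y)
  orthogonal-tail {X = X} {Y} heads≈0 X⊥Y = orthogonal-map tails-orthogonal
    where
    identity : ∀ g T → T ≡ 0ℤ ℤ.* g ℤ.+ T
    identity = solve-∀ℤ
    tails-orthogonal : ∀ {x y} → x ∈ X → y ∈ Y → dot (tail x) (tail y) ≈ 0ℤ
    tails-orthogonal {h ∷ t} {g ∷ s} x∈X y∈Y = begin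
      dot t s                 ≡⟨ identity g (dot t s) ⟩
      0ℤ ℤ.* g ℤ.+ dot t s    ≈⟨ +-cong (*-congʳ g (≈-sym (heads≈0 x∈X))) ≈-refl ⟩
      h ℤ.* g ℤ.+ dot t s     ≈⟨ X⊥Y x∈X y∈Y ⟩
      0ℤ                      ∎

  orthogonal-eliminate : ∀ {n} {X Y : List (Vec ℤ (suc n))} {x₀} → x₀ ∈ X →
                         Orthogonal X Y → Orthogonal (List.map (eliminate x₀) X) (List.map tail Y)
  orthogonal-eliminate {x₀ = x₀} x₀∈X X⊥Y = orthogonal-map λ {x} {y} x∈X y∈Y → begin
    dot (eliminate x₀ x) (tail y)                      ≡⟨ dot-eliminate x₀ x y ⟩
    head x₀ ℤ.* dot x y - head x ℤ.* dot x₀ y          ≈⟨ -‿cong (*-congˡ (head x₀) (X⊥Y x∈X y∈Y)) (*-congˡ (head x) (X⊥Y x₀∈X y∈Y)) ⟩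
    head x₀ ℤ.* 0ℤ - head x ℤ.* 0ℤ                     ≡⟨ identity (head x₀) (head x) ⟩
    0ℤ                                                 ∎
    where
    identity : ∀ c d → c ℤ.* 0ℤ - d ℤ.* 0ℤ ≡ 0ℤ
    identity = solve-∀ℤ

  DeterminesMod : ∀ {n} → Subset n → List (Vec ℤ n) → Set
  DeterminesMod S X = Determines _≈_ S (_∈ X)

  determines-inside : ∀ {n} {S : Subset n} {Y} → DeterminesMod S (List.map tail Y) → DeterminesMod (inside ∷ S) Y
  determines-inside S-determines {_ ∷ _} {_ ∷ _} y₁∈Y y₂∈Y (g₁≈g₂ , s₁≈s₂) =
    g₁≈g₂ , S-determines (∈-map⁺ tail y₁∈Y) (∈-map⁺ tail y₂∈Y) s₁≈s₂

  determines-outside : ∀ {n} {S : Subset n} {X} → (∀ {x} → x ∈ X → head x ≈ 0ℤ) →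
                       DeterminesMod S (List.map tail X) → DeterminesMod (outside ∷ S) X
  determines-outside heads≈0 S-determines {_ ∷ _} {_ ∷ _} x₁∈X x₂∈X t₁≈t₂ =
    ≈-trans (heads≈0 x₁∈X) (≈-sym (heads≈0 x₂∈X)) ,
    S-determines (∈-map⁺ tail x₁∈X) (∈-map⁺ tail x₂∈X) t₁≈t₂

  determines-pivot-row : ∀ {n} {S : Subset n} {X} x₀ → head x₀ ≉ 0ℤ →
                         DeterminesMod S (List.map (eliminate x₀) X) → DeterminesMod (inside ∷ S) X
  determines-pivot-row {S = S} x₀ h₀≉0 S-determines {_ ∷ _} {_ ∷ _} x₁∈X x₂∈X (h₁≈h₂ , t₁≈t₂) =
    h₁≈h₂ , eliminate-cancel x₀ h₀≉0 h₁≈h₂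
              (S-determines (∈-map⁺ (eliminate x₀) x₁∈X) (∈-map⁺ (eliminate x₀) x₂∈X)
                            (eliminate-agree x₀ S h₁≈h₂ t₁≈t₂))

  determines-pivot-column : ∀ {n} {S : Subset n} {Y} x₀ → head x₀ ≉ 0ℤ → (∀ {y} → y ∈ Y → dot x₀ y ≈ 0ℤ) →
                            DeterminesMod S (List.map tail Y) → DeterminesMod (outside ∷ S) Y
  determines-pivot-column (h₀ ∷ t₀) h₀≉0 x₀⊥Y S-determines {y₁@(g₁ ∷ s₁)} {y₂@(g₂ ∷ s₂)} y₁∈Y y₂∈Y s₁≈s₂ =
    *-cancelˡ h₀≉0 h₀g₁≈h₀g₂ , s₁≋s₂
    where
    s₁≋s₂ = S-determines (∈-map⁺ tail y₁∈Y) (∈-map⁺ tail y₂∈Y) s₁≈s₂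
    identity : ∀ h g T → h ℤ.* g ≡ (h ℤ.* g ℤ.+ T) - T
    identity = solve-∀ℤ
    h₀g₁≈h₀g₂ : h₀ ℤ.* g₁ ≈ h₀ ℤ.* g₂
    h₀g₁≈h₀g₂ = begin
      h₀ ℤ.* g₁               ≡⟨ identity h₀ g₁ (dot t₀ s₁) ⟩
      dot (h₀ ∷ t₀) y₁ - dot t₀ s₁  ≈⟨ -‿cong (≈-trans (x₀⊥Y y₁∈Y) (≈-sym (x₀⊥Y y₂∈Y))) (dot-congʳ t₀ s₁≋s₂) ⟩
      dot (h₀ ∷ t₀) y₂ - dot t₀ s₂  ≡⟨ identity h₀ g₂ (dot t₀ s₂) ⟨
      h₀ ℤ.* g₂               ∎

  -- Gaussian elimination, one column at a time: a column vanishing on X joins the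
  -- coordinate set of Y; otherwise a pivot row x₀ ∈ X is eliminated from X and
  -- its column joins the coordinate set of X.
  information-sets : ∀ {n} (X Y : List (Vec ℤ n)) → Orthogonal X Y →
                     ∃[ S ] DeterminesMod S X × DeterminesMod (∁ S) Y
  information-sets {zero} X Y _ = [] , (λ { {[]} {[]} _ _ _ → Unit.tt }) , (λ { {[]} {[]} _ _ _ → Unit.tt })
  information-sets {suc n} X Y X⊥Y with all? (λ x → head x ≈? 0ℤ) X
  ... | yes heads≈0 =
    let S , S-determines , ∁S-determines =
          information-sets (List.map tail X) (List.map tail Y) (orthogonal-tail (All-lookup heads≈0) X⊥Y)
    in outside ∷ S , determines-outside (All-lookup heads≈0) S-determines , determines-inside ∁S-determines
  ... | no ¬heads≈0 with find (¬All⇒Any¬ (λ x → head x ≈? 0ℤ) X ¬heads≈0)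
  ...   | x₀ , x₀∈X , h₀≉0 =
    let S , S-determines , ∁S-determines =
          information-sets (List.map (eliminate x₀) X) (List.map tail Y) (orthogonal-eliminate x₀∈X X⊥Y)
    in inside ∷ S , determines-pivot-row x₀ h₀≉0 S-determines ,
       determines-pivot-column x₀ h₀≉0 (X⊥Y x₀∈X) ∁S-determines

  bit : Bool → ℤ
  bit b = if b then 1ℤ else 0ℤ

  χ : ∀ {n} → Subset n → Vec ℤ n
  χ = map bit

  dot-χ : ∀ {n} (A B : Subset n) → dot (χ A) (χ B) ≡ + ∣ A ∩ B ∣
  dot-χ []      []      = refl
  dot-χ (a ∷ A) (b ∷ B) rewrite dot-χ A B with a | b
  ... | inside  | inside  = refl
  ... | inside  | outside = refl
  ... | outside | inside  = refl
  ... | outside | outside = refl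

  p∤1 : ¬ + p ℤ∣.∣ 1ℤ
  p∤1 p∣1 = ¬prime[1] (subst Prime (ℕ∣.∣1⇒≡1 (∣⇒∣ᵤ p∣1)) p-prime)

  bit-injective : ∀ {a b} → bit a ≈ bit b → a ≡ b
  bit-injective {inside}  {inside}  _     = refl
  bit-injective {outside} {outside} _     = refl
  bit-injective {inside}  {outside} 1≈0   = ⊥-elim (p∤1 (∣difference 1≈0))
  bit-injective {outside} {inside}  0≈1   = ⊥-elim (p∤1 (∣m⇒∣-m (∣difference 0≈1)))

  determines-members : ∀ {n} (S : Subset n) {F : Family n} →
                       DeterminesMod S (List.map χ F) → Determines _≡_ S (_∈ F)
  determines-members {n} S S-determines A∈F B∈F A~B =
    agree-map⁻ {R′ = _≈_} {f = bit} bit-injective (⊤ {n})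
      (S-determines (∈-map⁺ χ A∈F) (∈-map⁺ χ B∈F) (agree-map (λ { refl → ≈-refl }) S A~B))

  size*size≤2^n : ∀ {n} (F G : Family n) → (∀ {A B} → A ∈ F → B ∈ G → p ∣ ∣ A ∩ B ∣) →
                  size F * size G ≤ 2 ^ n
  size*size≤2^n F G p∣∣A∩B∣ =
    let S , S-determines , ∁S-determines = information-sets (List.map χ F) (List.map χ G) χF⊥χG
    in count*count≤2^n (_∈? F) (_∈? G) S (determines-members S S-determines) (determines-members (∁ S) ∁S-determines)
    where
    χF⊥χG : Orthogonal (List.map χ F) (List.map χ G)
    χF⊥χG = orthogonal-map λ {A} {B} A∈F B∈G →
      subst (_≈ 0ℤ) (sym (dot-χ A B)) (≈0-intro (∣ᵤ⇒∣ (p∣∣A∩B∣ A∈F B∈G)))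

prime-divisor : ∀ {ℓ} → 2 ≤ ℓ → ∃[ p ] Prime p × p ∣ ℓ
prime-divisor {ℓ} (s≤s (s≤s _)) with factorise ℓ
... | record { factors = p ∷ ps ; isFactorisation = ℓ≡p*Πps ; factorsPrime = p-prime ∷ _ } =
  p , p-prime , subst (p ∣_) (sym ℓ≡p*Πps) (m∣m*n (product ps))
... | record { factors = [] ; isFactorisation = () }

size*size≤2^n : ∀ {n ℓ} → 2 ≤ ℓ → (F G : Family n) → (∀ {A B} → A ∈ F → B ∈ G → ℓ ∣ ∣ A ∩ B ∣) →
                size F * size G ≤ 2 ^ n
size*size≤2^n 2≤ℓ F G ℓ∣∣A∩B∣ =
  let p , p-prime , p∣ℓ = prime-divisor 2≤ℓ
  in ModuloPrime.size*size≤2^n p p-prime F G (λ A∈F B∈G → ∣-trans p∣ℓ (ℓ∣∣A∩B∣ A∈F B∈G))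

-- Induction on the number of families

infixr 7 _∧_

_∧_ : ∀ {n} → Family n → Family n → Family n
F ∧ G = cartesianProductWith _∩_ F G

size*size≤2^n*size-∧ : ∀ {n} (F G : Family n) → size F * size G ≤ 2 ^ n * size (F ∧ G)
size*size≤2^n*size-∧ F G =
  count*count≤2^n*count-∩ (_∈? F) (_∈? G) (_∈? F ∧ G) (∈-cartesianProductWith⁺ _∩_)

IntersectionsDivisibleBy : ∀ {n} → ℕ → (k : ℕ) → (Fin k → Family n) → Set
IntersectionsDivisibleBy {n} ℓ k F = ∀ (S : Fin k → Subset n) → (∀ i → S i ∈ F i) → ℓ ∣ ∣ ⋂ k S ∣

meet₀₁ : ∀ {n k} → (Fin (2 + k) → Family n) → Fin (1 + k) → Family n
meet₀₁ F zero    = F zero ∧ F (suc zero)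
meet₀₁ F (suc i) = F (suc (suc i))

meet₀₁-divisible : ∀ {n ℓ} k (F : Fin (3 + k) → Family n) →
                   IntersectionsDivisibleBy ℓ (3 + k) F → IntersectionsDivisibleBy ℓ (2 + k) (meet₀₁ F)
meet₀₁-divisible {ℓ = ℓ} k F F-divisible S S∈ with ∈-cartesianProductWith⁻ _∩_ (F zero) (F (suc zero)) (S∈ zero)
... | A , B , A∈F₀ , B∈F₁ , S₀≡A∩B =
  subst (λ C → ℓ ∣ ∣ C ∣) A∩[B∩R]≡S₀∩R (F-divisible (λ { zero → A ; (suc zero) → B ; (suc (suc i)) → S (suc i) })
                                                   (λ { zero → A∈F₀ ; (suc zero) → B∈F₁ ; (suc (suc i)) → S∈ (suc i) }))
  where
  R = ⋂ (1 + k) (λ i → S (suc i))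
  A∩[B∩R]≡S₀∩R : A ∩ (B ∩ R) ≡ S zero ∩ R
  A∩[B∩R]≡S₀∩R = trans (sym (∩-assoc A B R)) (cong (_∩ R) (sym S₀≡A∩B))

product-bound : ∀ {n ℓ} k → 2 ≤ ℓ → (F : Fin (2 + k) → Family n) → IntersectionsDivisibleBy ℓ (2 + k) F →
                vfoldr _*_ 1 (λ i → size (F i)) ≤ 2 ^ ((1 + k) * n)
product-bound {n} {ℓ} zero 2≤ℓ F F-divisible = begin
  size (F zero) * (size (F (suc zero)) * 1)   ≡⟨ cong (size (F zero) *_) (*-identityʳ _) ⟩
  size (F zero) * size (F (suc zero))         ≤⟨ size*size≤2^n 2≤ℓ (F zero) (F (suc zero)) ℓ∣∣A∩B∣ ⟩
  2 ^ n                                       ≡⟨ cong (2 ^_) (+-identityʳ n) ⟨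
  2 ^ (n + 0)                                 ∎
  where
  open ≤-Reasoning
  ℓ∣∣A∩B∣ : ∀ {A B} → A ∈ F zero → B ∈ F (suc zero) → ℓ ∣ ∣ A ∩ B ∣
  ℓ∣∣A∩B∣ {A} {B} A∈F₀ B∈F₁ =
    subst (λ C → ℓ ∣ ∣ A ∩ C ∣) (∩-identityʳ B)
          (F-divisible (λ { zero → A ; (suc zero) → B }) λ { zero → A∈F₀ ; (suc zero) → B∈F₁ })
product-bound {n} (suc k) 2≤ℓ F F-divisible = begin
  size F₀ * (size F₁ * rest)              ≡⟨ *-assoc (size F₀) (size F₁) rest ⟨
  size F₀ * size F₁ * rest                ≤⟨ *-monoˡ-≤ rest (size*size≤2^n*size-∧ F₀ F₁) ⟩
  2 ^ n * size (F₀ ∧ F₁) * rest           ≡⟨ *-assoc (2 ^ n) (size (F₀ ∧ F₁)) rest ⟩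
  2 ^ n * (size (F₀ ∧ F₁) * rest)         ≤⟨ *-monoʳ-≤ (2 ^ n) (product-bound k 2≤ℓ (meet₀₁ F) (meet₀₁-divisible k F F-divisible)) ⟩
  2 ^ n * 2 ^ ((1 + k) * n)               ≡⟨ ^-distribˡ-+-* 2 n ((1 + k) * n) ⟨
  2 ^ ((2 + k) * n)                       ∎
  where
  open ≤-Reasoning
  F₀ = F zero
  F₁ = F (suc zero)
  rest = vfoldr _*_ 1 (λ i → size (F (suc (suc i))))

vfoldr-cong : ∀ {A B : Set} (f : A → B → B) (e : B) {k} {u v : Fin k → A} →
              (∀ i → u i ≡ v i) → vfoldr f e u ≡ vfoldr f e v
vfoldr-cong f e {zero}  u≡v = refl
vfoldr-cong f e {suc k} u≡v = cong₂ f (u≡v zero) (vfoldr-cong f e (u≡v ∘ suc))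

theorem6p1 : (ℓ k n : ℕ) → 2 ≤ ℓ → 2 ≤ k → (F : Fin k → Family n) → (∀ i → Unique (F i)) → (∀ (S : Fin k → Subset n) → (∀ i → S i ∈ F i) → ℓ ∣ ∣ ⋂ k S ∣) → vfoldr _*_ 1 (λ i → length (F i)) ≤ 2 ^ ((k ∸ 1) * n)
theorem6p1 ℓ (suc (suc k)) n 2≤ℓ (s≤s (s≤s _)) F unique F-divisible = begin
  vfoldr _*_ 1 (λ i → length (F i))   ≡⟨ vfoldr-cong _*_ 1 (λ i → size≡length (F i) (unique i)) ⟨
  vfoldr _*_ 1 (λ i → size (F i))     ≤⟨ product-bound k 2≤ℓ F F-divisible ⟩
  2 ^ ((1 + k) * n)                   ∎
  where open ≤-Reasoning
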